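{- Let $G$ be a finite group, $S \subseteq G$ with $1 \notin S$ and $S^{ -1}=S$, and suppose $C \subseteq G$ is a total perfect code in $\mathrm{Cay}(G, S)$. If $gC = Cg$ for every $g \in S$, then there exists a pseudocovering $p: \mathrm{Cay}(G, S) \to K_{|S|}$ whose fibres are exactly the sets $gC$, $g \in S$. Moreover, if $C$ is a normal subgroup of $G$, then $p$ is a $C$-pseudocovering (with $C$ acting on $\mathrm{Cay}(G,S)$ by right multiplication $x \mapsto xc$).
   Context: For a finite group $G$ and $S \subseteq G$ with $1 \notin S$ and $S^{ -1}=S$, the Cayley graph $\mathrm{Cay}(G,S)$ has vertex set $G$, with $x, y$ adjacent iff $xy^{ -1} \in S$. A total perfect code in a graph is a set $C$ of vertices such that every vertex is adjacent to exactly one vertex of $C$. $K_n$ is the complete graph on $n$ vertices. A covering projection from $\Sigma$ to $\Gamma$ is a surjective map $p: V(\Sigma)\to V(\Gamma)$ whose restriction to each neighbourhood $\Sigma(u)$ is a bijection onto $\Gamma(p(u))$. A pseudocovering $p: \Sigma \to \Gamma$ is a surjective map $p: V(\Sigma) \to V(\Gamma)$ such that for each $v \in V(\Gamma)$ the induced subgraph $\Sigma[p^{ -1}(v)]$ is a matching (each vertex of $p^{ -1}(v)$ has exactly one neighbour in $p^{ -1}(v)$), and $p$ is a covering projection from $\Sigma^*$ to $\Gamma$, where $\Sigma^*$ is obtained from $\Sigma$ by deleting the edges inside each fibre $p^{ -1}(v)$; the sets $p^{ -1}(v)$ are its fibres. A pseudocovering $p:\Sigma \to \Gamma$ is an $H$-pseudocovering,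 for a subgroup $H$ of $\mathrm{Aut}(\Sigma)$, if there is an isomorphism $h: \Gamma \to \Sigma/\mathcal{P}_H$ such that the quotient map $V(\Sigma) \to V(\Sigma/\mathcal{P}_H)$ equals $h \circ p$, where $\mathcal{P}_H$ is the partition of $V(\Sigma)$ into $H$-orbits and $\Sigma/\mathcal{P}_H$ is the quotient graph whose vertices are the $H$-orbits, two distinct orbits being adjacent iff some edge of $\Sigma$ joins them. -}

module Defs where

open import Level using (0ℓ)
open import Data.Nat using (ℕ)
open import Data.Fin using (Fin)
open import Data.Fin.Subset using (Subset; _∈_)
open import Data.Product using (Σ; ∃; _×_; _,_)
open import Relation.Binary.PropositionalEquality using (_≡_; _≢_)
open import Relation.Nullary using (¬_)
open import Relation.Unary using (Pred; _≐_)
open import Algebra.Core using (Op₁; Op₂)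
open import Algebra.Structures using (IsGroup)
open import Function.Bundles using (_⇔_)

-- A finite group: a group structure (with propositional equality) on Fin n.
-- Every finite group is isomorphic to one of this form.
record FiniteGroup : Set where
  field
    n       : ℕ
    _∙_     : Op₂ (Fin n)
    ε       : Fin n
    _⁻¹     : Op₁ (Fin n)
    isGroup : IsGroup _≡_ _∙_ ε _⁻¹
  infixl 7 _∙_
  infix 8 _⁻¹

Graph : Set → Set₁
Graph V = V → V → Set

module _ (G : FiniteGroup) where
  open FiniteGroup G

  Cay : Subset n → Graph (Fin n)
  Cay S x y = (x ∙ y ⁻¹) ∈ S

  leftCoset : Fin n → Subset n → Pred (Fin n) 0ℓ
  leftCoset g C x = ∃ λ c → c ∈ C × x ≡ g ∙ c

  rightCoset : Fin n → Subset n → Pred (Fin n) 0ℓ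
  rightCoset g C x = ∃ λ c → c ∈ C × x ≡ c ∙ g

  -- orbit of x under the right-multiplication action of C: xC
  rightMulOrbit : Subset n → Fin n → Pred (Fin n) 0ℓ
  rightMulOrbit C x = leftCoset x C

  IsNormalSubgroup : Subset n → Set
  IsNormalSubgroup C =
    ε ∈ C
    × (∀ a b → a ∈ C → b ∈ C → (a ∙ b) ∈ C)
    × (∀ a → a ∈ C → (a ⁻¹) ∈ C)
    × (∀ g c → c ∈ C → (g ∙ c ∙ g ⁻¹) ∈ C)

Complete : (m : ℕ) → Graph (Fin m)
Complete m u v = u ≢ v

IsTotalPerfectCode : ∀ {k} → Graph (Fin k) → Subset k → Set
IsTotalPerfectCode Γ C =
  ∀ x → ∃ λ c → c ∈ C × Γ x c × (∀ c′ → c′ ∈ C → Γ x c′ → c′ ≡ c)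

module _ {V W : Set} (Σg : Graph V) (Γ : Graph W) (p : V → W) where

  -- Σ* : delete the edges inside fibres
  StarAdj : Graph V
  StarAdj u w = Σg u w × p w ≢ p u

  IsCoveringProjection : Set
  IsCoveringProjection =
    (∀ w → ∃ λ v → p v ≡ w)
    × (∀ u →
        (∀ w → StarAdj u w → Γ (p u) (p w))
        × (∀ w w′ → StarAdj u w → StarAdj u w′ → p w ≡ p w′ → w ≡ w′)
        × (∀ z → Γ (p u) z → ∃ λ w → StarAdj u w × p w ≡ z))

  IsPseudocovering : Set
  IsPseudocovering =
    (∀ w → ∃ λ v → p v ≡ w)
    -- each fibre induces a perfect matching
    × (∀ u → ∃ λ w → Σg u w × p w ≡ p u
                × (∀ w′ → Σg u w′ → p w′ ≡ p u → w′ ≡ w))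
    × IsCoveringProjection

  QuotAdj : Pred V 0ℓ → Pred V 0ℓ → Set
  QuotAdj O O′ = ¬ (O ≐ O′) × ∃ λ x → ∃ λ y → O x × O′ y × Σg x y

  -- p is an H-pseudocovering, where orb x is the H-orbit of x:
  -- there is an isomorphism h : Γ → Σ / P_H (vertices of Σ/P_H being the
  -- orbits, compared extensionally) with (quotient map) = h ∘ p.
  IsOrbitPseudocovering : (orb : V → Pred V 0ℓ) → Set₁
  IsOrbitPseudocovering orb =
    IsPseudocovering
    × Σ (W → Pred V 0ℓ) λ h →
        (∀ w → ∃ λ x → h w ≐ orb x)
        × (∀ w w′ → h w ≐ h w′ → w ≡ w′)
        × (∀ x → ∃ λ w → h w ≐ orb x)
        × (∀ w w′ → Γ w w′ ⇔ QuotAdj (h w) (h w′))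
        × (∀ x → h (p x) ≐ orb x)

module Submission where

-- Every x ∈ G has a
-- unique code neighbour c(x) ∈ C, and its label ℓ(x) = x c(x)⁻¹ lies in S.
-- For g ∈ S one has x ∈ gC iff ℓ(x) = g, so the cosets gC (g ∈ S) partition G
-- and p(x) = "position of ℓ(x) in S" is a map G → Fin |S| with fibres gC.
-- Since hC = Ch, a vertex u is adjacent to c h (c ∈ C) iff u h⁻¹ is adjacent
-- to c, so u has exactly one neighbour in every fibre hC.
--
-- The corollary then assembles these pieces.

open import Defs
open import Data.Fin using (Fin)
open import Data.Fin.Subset using (Subset; _∈_; _∉_; ∣_∣)
open import Data.Product using (∃; _×_)
open import Relation.Binary.PropositionalEquality using (_≡_)
open import Relation.Unary using (_≐_)

open import Level using (0ℓ)
open import Data.Nat using (ℕ)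
open import Data.Bool using (true; false)
open import Data.Fin using (zero; suc)
open import Data.Vec using (_∷_; here; there)
open import Data.Vec.Properties.WithK using ([]=-irrelevant)
open import Data.Product using (_,_; proj₁; proj₂)
open import Function.Base using (id)
open import Function.Bundles using (_⇔_; mk⇔; Equivalence)
open import Relation.Binary.PropositionalEquality
  using (refl; sym; trans; cong; subst; module ≡-Reasoning)
open import Relation.Unary using (Pred)
open import Relation.Unary.Properties using (≐-trans; ≐-sym)
open import Algebra.Bundles using (Group)
open import Algebra.Structures using (module IsGroup)
import Algebra.Properties.Group as GroupProperties

elem : ∀ {n} (S : Subset n) → Fin ∣ S ∣ → Fin n
elem (true  ∷ S) zero    = zero
elem (true  ∷ S) (suc v) = suc (elem S v)
elem (false ∷ S) v       = suc (elem S v)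

elem∈ : ∀ {n} (S : Subset n) v → elem S v ∈ S
elem∈ (true  ∷ S) zero    = here
elem∈ (true  ∷ S) (suc v) = there (elem∈ S v)
elem∈ (false ∷ S) v       = there (elem∈ S v)

index : ∀ {n} (S : Subset n) {x} → x ∈ S → Fin ∣ S ∣
index (true  ∷ S) here      = zero
index (true  ∷ S) (there p) = suc (index S p)
index (false ∷ S) (there p) = index S p

elem-index : ∀ {n} (S : Subset n) {x} (x∈S : x ∈ S) → elem S (index S x∈S) ≡ x
elem-index (true  ∷ S) here      = refl
elem-index (true  ∷ S) (there p) = cong suc (elem-index S p)
elem-index (false ∷ S) (there p) = cong suc (elem-index S p)

index-elem : ∀ {n} (S : Subset n) v → index S (elem∈ S v) ≡ v
index-elem (true  ∷ S) zero    = refl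
index-elem (true  ∷ S) (suc v) = cong suc (index-elem S v)
index-elem (false ∷ S) v       = index-elem S v

-- positions of members agree iff the members do (membership proofs are unique)
index≡⇔≡ : ∀ {n} (S : Subset n) {x y} (x∈S : x ∈ S) (y∈S : y ∈ S) →
           index S x∈S ≡ index S y∈S ⇔ x ≡ y
index≡⇔≡ S {x} {y} x∈S y∈S = mk⇔ injective congruent
  where
  injective : index S x∈S ≡ index S y∈S → x ≡ y
  injective e = trans (sym (elem-index S x∈S))
                      (trans (cong (elem S) e) (elem-index S y∈S))
  congruent : x ≡ y → index S x∈S ≡ index S y∈S
  congruent refl = cong (index S) ([]=-irrelevant x∈S y∈S)

Fibre : {V : Set} {m : ℕ} → (V → Fin m) → Fin m → Pred V 0ℓ
Fibre p v x = p x ≡ v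

module _ {V : Set} {m : ℕ} (Γ : Graph V) (p : V → Fin m) where

  UniqueFibreNeighbours : Set
  UniqueFibreNeighbours =
    ∀ u v → ∃ λ w → Γ u w × p w ≡ v × (∀ w′ → Γ u w′ → p w′ ≡ v → w′ ≡ w)

  -- With one neighbour per fibre, the neighbour in the own fibre gives the
  -- matching, and the others give a bijection Γ*(u) ≅ K_m(p u).
  uniqueFibreNeighbours⇒pseudocovering :
    V → UniqueFibreNeighbours → IsPseudocovering Γ (Complete m) p
  uniqueFibreNeighbours⇒pseudocovering v₀ nb =
    surjective , (λ u → nb u (p u)) , surjective , λ u → maps u , injective u , onto u
    where
    surjective : ∀ v → ∃ λ w → p w ≡ v
    surjective v = let (w , _ , pw≡v , _) = nb v₀ v in w , pw≡v

    maps : ∀ u w → StarAdj Γ (Complete m) p u w → Complete m (p u) (p w)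
    maps u w (_ , pw≢pu) pu≡pw = pw≢pu (sym pu≡pw)

    injective : ∀ u w w′ → StarAdj Γ (Complete m) p u w → StarAdj Γ (Complete m) p u w′ →
                p w ≡ p w′ → w ≡ w′
    injective u w w′ (uw , _) (uw′ , _) pw≡pw′ =
      let (_ , _ , _ , unique) = nb u (p w)
      in trans (unique w uw refl) (sym (unique w′ uw′ (sym pw≡pw′)))

    onto : ∀ u z → Complete m (p u) z → ∃ λ w → StarAdj Γ (Complete m) p u w × p w ≡ z
    onto u z pu≢z =
      let (w , uw , pw≡z , _) = nb u z
      in w , (uw , λ pw≡pu → pu≢z (trans (sym pw≡pu) pw≡z)) , pw≡z

  -- If the fibres of a pseudocovering onto K_m are exactly the orbits orb x,
  -- then v ↦ Fibre p v identifies K_m with the quotient by the orbits.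
  fibresAreOrbits⇒orbitPseudocovering :
    (orb : V → Pred V 0ℓ) → IsPseudocovering Γ (Complete m) p →
    (∀ x → Fibre p (p x) ≐ orb x) → IsOrbitPseudocovering Γ (Complete m) p orb
  fibresAreOrbits⇒orbitPseudocovering orb pc@(surjective , _ , _ , covering) fibre≐orb =
    pc , Fibre p , isOrbit , injective , (λ x → p x , fibre≐orb x) , adjacency , fibre≐orb
    where
    isOrbit : ∀ v → ∃ λ x → Fibre p v ≐ orb x
    isOrbit v = let (x , px≡v) = surjective v
                in x , subst (λ t → Fibre p t ≐ orb x) px≡v (fibre≐orb x)

    injective : ∀ v v′ → Fibre p v ≐ Fibre p v′ → v ≡ v′
    injective v v′ (⊆ , _) = let (x , px≡v) = surjective v in trans (sym px≡v) (⊆ px≡v)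

    adjacency : ∀ v v′ → Complete m v v′ ⇔ QuotAdj Γ (Complete m) p (Fibre p v) (Fibre p v′)
    adjacency v v′ = mk⇔ toQuot fromQuot
      where
      toQuot : Complete m v v′ → QuotAdj Γ (Complete m) p (Fibre p v) (Fibre p v′)
      toQuot v≢v′ =
        let (u , pu≡v) = surjective v
            (w , (uw , _) , pw≡v′) = proj₂ (proj₂ (covering u)) v′
                                        (λ pu≡v′ → v≢v′ (trans (sym pu≡v) pu≡v′))
        in (λ eq → v≢v′ (injective v v′ eq)) , u , w , pu≡v , pw≡v′ , uw
      fromQuot : QuotAdj Γ (Complete m) p (Fibre p v) (Fibre p v′) → Complete m v v′
      fromQuot (distinct , _) refl = distinct (id , id)

module GroupFacts (G : FiniteGroup) where
  open FiniteGroup G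
  open IsGroup isGroup public using (_//_)
  open IsGroup isGroup using (assoc)

  group : Group 0ℓ 0ℓ
  group = record { isGroup = isGroup }

  open GroupProperties group public using (//-rightDividesˡ)
  open GroupProperties group using (//-rightDividesʳ; ⁻¹-anti-homo-∙)

  divide-coset : ∀ {x g c} → x ≡ g ∙ c → x // c ≡ g
  divide-coset {c = c} refl = //-rightDividesʳ c _

  -- u (c h)⁻¹ = (u h⁻¹) c⁻¹: u is adjacent to c h iff u h⁻¹ is adjacent to c
  //-shift : ∀ u c h → u // (c ∙ h) ≡ (u // h) // c
  //-shift u c h = trans (cong (u ∙_) (⁻¹-anti-homo-∙ c h)) (sym (assoc u (h ⁻¹) (c ⁻¹)))

  leftCoset-absorb : ∀ {C : Subset n} →
    (∀ a b → a ∈ C → b ∈ C → (a ∙ b) ∈ C) → (∀ a → a ∈ C → (a ⁻¹) ∈ C) →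
    ∀ g {c} → c ∈ C → leftCoset G (g ∙ c) C ≐ leftCoset G g C
  leftCoset-absorb {C} mul inv g {c} c∈C = shrink , grow
    where
    open ≡-Reasoning
    shrink : ∀ {x} → leftCoset G (g ∙ c) C x → leftCoset G g C x
    shrink (d , d∈C , x≡gcd) = c ∙ d , mul _ _ c∈C d∈C , trans x≡gcd (assoc g c d)
    grow : ∀ {x} → leftCoset G g C x → leftCoset G (g ∙ c) C x
    grow {x} (d , d∈C , x≡gd) = c ⁻¹ ∙ d , mul _ _ (inv c c∈C) d∈C , (begin
      x                  ≡⟨ x≡gd ⟩
      g ∙ d              ≡⟨ cong (_∙ d) (//-rightDividesʳ c g) ⟨
      ((g ∙ c) // c) ∙ d ≡⟨ assoc (g ∙ c) (c ⁻¹) d ⟩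
      g ∙ c ∙ (c ⁻¹ ∙ d) ∎)

module Labelling (G : FiniteGroup) (S C : Subset (FiniteGroup.n G))
                 (code : IsTotalPerfectCode (Cay G S) C) where
  open FiniteGroup G
  open GroupFacts G

  codeNeighbour : Fin n → Fin n
  codeNeighbour x = proj₁ (code x)

  codeNeighbour∈C : ∀ x → codeNeighbour x ∈ C
  codeNeighbour∈C x = proj₁ (proj₂ (code x))

  codeNeighbour-unique : ∀ x c → c ∈ C → Cay G S x c → c ≡ codeNeighbour x
  codeNeighbour-unique x = proj₂ (proj₂ (proj₂ (code x)))

  label : Fin n → Fin n
  label x = x // codeNeighbour x

  label∈S : ∀ x → label x ∈ S
  label∈S x = proj₁ (proj₂ (proj₂ (code x)))

  label-factorises : ∀ x → x ≡ label x ∙ codeNeighbour x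
  label-factorises x = sym (//-rightDividesˡ (codeNeighbour x) x)

  leftCoset≐label : ∀ {g} → g ∈ S → leftCoset G g C ≐ (λ x → label x ≡ g)
  leftCoset≐label {g} g∈S = labelled , (λ { refl → _ , codeNeighbour∈C _ , label-factorises _ })
    where
    labelled : ∀ {x} → leftCoset G g C x → label x ≡ g
    labelled {x} (c , c∈C , x≡gc) =
      let c-adjacent = subst (_∈ S) (sym (divide-coset x≡gc)) g∈S
      in trans (cong (x //_) (sym (codeNeighbour-unique x c c∈C c-adjacent)))
               (divide-coset x≡gc)

  position : Fin n → Fin ∣ S ∣
  position x = index S (label∈S x)

  -- p x = position of g  ⇔  ℓ(x) = g  ⇔  x ∈ gC
  fibre≐coset : ∀ {g} (g∈S : g ∈ S) → Fibre position (index S g∈S) ≐ leftCoset G g C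
  fibre≐coset g∈S = ≐-trans (Equivalence.to (index≡⇔≡ S _ g∈S) , Equivalence.from (index≡⇔≡ S _ g∈S))
                            (≐-sym (leftCoset≐label g∈S))

  fibre≐elemCoset : ∀ v → Fibre position v ≐ leftCoset G (elem S v) C
  fibre≐elemCoset v = subst (λ t → Fibre position t ≐ leftCoset G (elem S v) C)
                            (index-elem S v) (fibre≐coset (elem∈ S v))

  -- when C is a subgroup, the fibre through x is xC = ℓ(x) c(x) C = ℓ(x) C
  fibre≐rightMulOrbit : IsNormalSubgroup G C → ∀ x → Fibre position (position x) ≐ rightMulOrbit G C x
  fibre≐rightMulOrbit (_ , mul , inv , _) x =
    ≐-trans (fibre≐coset (label∈S x))
            (subst (λ t → leftCoset G (label x) C ≐ leftCoset G t C) (sym (label-factorises x))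
                   (≐-sym (leftCoset-absorb mul inv (label x) (codeNeighbour∈C x))))

module CommutingCosets (G : FiniteGroup) (S C : Subset (FiniteGroup.n G))
                       (code : IsTotalPerfectCode (Cay G S) C)
                       (commute : ∀ g → g ∈ S → leftCoset G g C ≐ rightCoset G g C) where
  open FiniteGroup G
  open GroupFacts G
  open Labelling G S C code

  -- the neighbours of u in hC = Ch are the c h with c adjacent to u h⁻¹,
  -- so the unique one is c(u h⁻¹) h
  uniqueNeighbourInCoset : ∀ {h} → h ∈ S → ∀ u →
    ∃ λ w → Cay G S u w × leftCoset G h C w
          × (∀ w′ → Cay G S u w′ → leftCoset G h C w′ → w′ ≡ w)
  uniqueNeighbourInCoset {h} h∈S u = c ∙ h , adjacent , inCoset , unique
    where
    c = codeNeighbour (u // h)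

    adjacent : Cay G S u (c ∙ h)
    adjacent = subst (_∈ S) (sym (//-shift u c h)) (label∈S (u // h))

    inCoset : leftCoset G h C (c ∙ h)
    inCoset = proj₂ (commute h h∈S) (c , codeNeighbour∈C _ , refl)

    unique : ∀ w′ → Cay G S u w′ → leftCoset G h C w′ → w′ ≡ c ∙ h
    unique w′ uw′ w′∈hC =
      let (c′ , c′∈C , w′≡c′h) = proj₁ (commute h h∈S) w′∈hC
          c′-adjacent = subst (_∈ S) (trans (cong (u //_) w′≡c′h) (//-shift u c′ h)) uw′
      in trans w′≡c′h (cong (_∙ h) (codeNeighbour-unique (u // h) c′ c′∈C c′-adjacent))

  uniqueFibreNeighbours : UniqueFibreNeighbours (Cay G S) position
  uniqueFibreNeighbours u v =
    let (to , from) = fibre≐elemCoset v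
        (w , uw , w∈C , unique) = uniqueNeighbourInCoset (elem∈ S v) u
    in w , uw , from w∈C , λ w′ uw′ pw′≡v → unique w′ uw′ (to pw′≡v)

corollary3p2 : (G : FiniteGroup) → (S C : Subset (FiniteGroup.n G))
    → FiniteGroup.ε G ∉ S
    → (∀ g → g ∈ S → FiniteGroup._⁻¹ G g ∈ S)
    → IsTotalPerfectCode (Cay G S) C
    → (∀ g → g ∈ S → leftCoset G g C ≐ rightCoset G g C)
    → ∃ λ (p : Fin (FiniteGroup.n G) → Fin ∣ S ∣)
    → IsPseudocovering (Cay G S) (Complete ∣ S ∣) p
    × (∀ v → ∃ λ g → g ∈ S × (λ x → p x ≡ v) ≐ leftCoset G g C)
    × (∀ g → g ∈ S → ∃ λ v → (λ x → p x ≡ v) ≐ leftCoset G g C)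
    × (IsNormalSubgroup G C
    → IsOrbitPseudocovering (Cay G S) (Complete ∣ S ∣) p (rightMulOrbit G C))
corollary3p2 G S C _ _ code commute =
  position , pseudocovering
  , (λ v → elem S v , elem∈ S v , fibre≐elemCoset v)
  , (λ g g∈S → index S g∈S , fibre≐coset g∈S)
  , λ normal → fibresAreOrbits⇒orbitPseudocovering (Cay G S) position (rightMulOrbit G C)
                 pseudocovering (fibre≐rightMulOrbit normal)
  where
  open Labelling G S C code
  open CommutingCosets G S C code commute
  pseudocovering : IsPseudocovering (Cay G S) (Complete ∣ S ∣) position
  pseudocovering = uniqueFibreNeighbours⇒pseudocovering (Cay G S) position
                     (FiniteGroup.ε G) uniqueFibreNeighbours
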